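{- Let $k\ge 3$. If $S_1,\dots,S_k$ are $(k-2)$-element sets such that the union $S_i\cup S_j$ is the same for all $1\le i<j\le k$, then $S_1=\cdots=S_k$. -}

module Defs where

-- Every element of the common union U of the pairwise unions misses at most one
-- of the k sets, so counting incidences gives (k − 1)∣U∣ ≤ ∑ᵢ ∣Sᵢ∣ = k(k − 2)
-- < (k − 1)². Hence ∣U∣ ≤ k − 2 = ∣Sᵢ∣, and as Sᵢ ⊆ U this forces Sᵢ = U.
module Submission where

open import Defs
open import Data.Nat using (ℕ; _≤_; _∸_)
open import Data.Fin using (Fin; _<_)
open import Data.Fin.Subset using (Subset; _∪_; ∣_∣)
open import Relation.Binary.PropositionalEquality using (_≡_)

open import Data.Bool.Base using (Bool; true; false; _∨_; if_then_else_)
open import Data.Fin.Base using (zero; suc; punchIn)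
open import Data.Fin.Properties using (<-cmp; suc-injective; punchInᵢ≢i)
open import Data.Fin.Subset.Properties using (∪-comm; ∣p∣≤∣p∪q∣)
open import Data.Nat.Base using (zero; suc; _+_; _*_; z≤n; s≤s)
open import Data.Nat.Properties
  using (≤-trans; ≤-reflexive; m≤n+m∸n; n≮n; <⇒≤pred; +-mono-≤; *-cancelˡ-<;
         *-zeroʳ; *-identityʳ; *-distribˡ-+; +-0-commutativeMonoid; module ≤-Reasoning)
open import Data.Nat.Solver using (module +-*-Solver)
open import Data.Vec.Base using ([]; _∷_)
open import Function.Base using (_∘_)
open import Relation.Binary.Definitions using (tri<; tri≈; tri>)
open import Relation.Binary.PropositionalEquality
  using (_≢_; refl; sym; trans; cong; subst; subst₂; module ≡-Reasoning)
open import Relation.Nullary.Negation using (contradiction)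

open import Algebra.Properties.CommutativeMonoid.Sum +-0-commutativeMonoid
  using (sum-syntax; ∑-distrib-+; sum-cong-≗)

private variable
  k n : ℕ

indicator : Bool → ℕ
indicator b = if b then 1 else 0

∣x∷p∣≡indicator[x]+∣p∣ : ∀ x (p : Subset n) → ∣ x ∷ p ∣ ≡ indicator x + ∣ p ∣
∣x∷p∣≡indicator[x]+∣p∣ true  p = refl
∣x∷p∣≡indicator[x]+∣p∣ false p = refl

∑-const : ∀ k c → ∑[ i < k ] c ≡ k * c
∑-const zero    c = refl
∑-const (suc k) c = cong (c +_) (∑-const k c)

∣p∪q∣≤∣p∣⇒p∪q≡p : ∀ (p q : Subset n) → ∣ p ∪ q ∣ ≤ ∣ p ∣ → p ∪ q ≡ p
∣p∪q∣≤∣p∣⇒p∪q≡p []          []          _       = refl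
∣p∪q∣≤∣p∣⇒p∪q≡p (true ∷ p)  (y ∷ q)     (s≤s h) = cong (true ∷_) (∣p∪q∣≤∣p∣⇒p∪q≡p p q h)
∣p∪q∣≤∣p∣⇒p∪q≡p (false ∷ p) (false ∷ q) h       = cong (false ∷_) (∣p∪q∣≤∣p∣⇒p∪q≡p p q h)
∣p∪q∣≤∣p∣⇒p∪q≡p (false ∷ p) (true ∷ q)  h       =
  contradiction (≤-trans h (∣p∣≤∣p∪q∣ p q)) (n≮n ∣ p ∪ q ∣)

pairwise-∨-true⇒∑≥k∸1 : (b : Fin k → Bool) → (∀ i j → i ≢ j → b i ∨ b j ≡ true) →
  k ∸ 1 ≤ ∑[ i < k ] indicator (b i)
pairwise-∨-true⇒∑≥k∸1 {zero}  b _ = z≤n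
pairwise-∨-true⇒∑≥k∸1 {suc k} b h with b zero in b₀
... | true  = ≤-trans (m≤n+m∸n k 1) (s≤s (pairwise-∨-true⇒∑≥k∸1 (b ∘ suc) h-suc))
  where
  h-suc : ∀ i j → i ≢ j → b (suc i) ∨ b (suc j) ≡ true
  h-suc i j i≢j = h (suc i) (suc j) (i≢j ∘ suc-injective)
... | false = ≤-reflexive (begin
  k                                ≡⟨ *-identityʳ k ⟨
  k * 1                            ≡⟨ ∑-const k 1 ⟨
  ∑[ i < k ] 1                     ≡⟨ sum-cong-≗ (cong indicator ∘ rest-true) ⟨
  ∑[ i < k ] indicator (b (suc i)) ∎)
  where
  open ≡-Reasoning
  rest-true : ∀ i → b (suc i) ≡ true
  rest-true i = subst (λ x → x ∨ b (suc i) ≡ true) b₀ (h zero (suc i) λ ())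

pairwise-∨⇒∑≥ : (b : Fin k → Bool) (u : Bool) → (∀ i j → i ≢ j → b i ∨ b j ≡ u) →
  (k ∸ 1) * indicator u ≤ ∑[ i < k ] indicator (b i)
pairwise-∨⇒∑≥ {k} b false _ = ≤-trans (≤-reflexive (*-zeroʳ (k ∸ 1))) z≤n
pairwise-∨⇒∑≥ {k} b true  h = ≤-trans (≤-reflexive (*-identityʳ (k ∸ 1))) (pairwise-∨-true⇒∑≥k∸1 b h)

-- Double counting, one coordinate at a time: each coordinate of U is
-- covered by at least k ∸ 1 of the sets.
pairwise-∪⇒∑≥ : (S : Fin k → Subset n) (U : Subset n) → (∀ i j → i ≢ j → S i ∪ S j ≡ U) →
  (k ∸ 1) * ∣ U ∣ ≤ ∑[ i < k ] ∣ S i ∣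
pairwise-∪⇒∑≥ {k} S []      _ = ≤-trans (≤-reflexive (*-zeroʳ (k ∸ 1))) z≤n
pairwise-∪⇒∑≥ {k} S (u ∷ U) h = begin
  (k ∸ 1) * ∣ u ∷ U ∣                                   ≡⟨ cong ((k ∸ 1) *_) (∣x∷p∣≡indicator[x]+∣p∣ u U) ⟩
  (k ∸ 1) * (indicator u + ∣ U ∣)                        ≡⟨ *-distribˡ-+ (k ∸ 1) (indicator u) ∣ U ∣ ⟩
  (k ∸ 1) * indicator u + (k ∸ 1) * ∣ U ∣                ≤⟨ +-mono-≤ (pairwise-∨⇒∑≥ (head ∘ S) u heads)
                                                                      (pairwise-∪⇒∑≥ (tail ∘ S) U tails) ⟩
  ∑[ i < k ] indicator (head (S i)) + ∑[ i < k ] ∣ tail (S i) ∣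
                                                         ≡⟨ ∑-distrib-+ (indicator ∘ head ∘ S) (∣_∣ ∘ tail ∘ S) ⟨
  ∑[ i < k ] (indicator (head (S i)) + ∣ tail (S i) ∣)   ≡⟨ sum-cong-≗ (λ i → ∣x∷p∣≡indicator[x]+∣p∣ (head (S i)) (tail (S i))) ⟨
  ∑[ i < k ] ∣ head (S i) ∷ tail (S i) ∣                 ≡⟨ sum-cong-≗ (λ i → cong ∣_∣ (head∷tail (S i))) ⟩
  ∑[ i < k ] ∣ S i ∣                                     ∎
  where
  open ≤-Reasoning
  head : Subset (suc n) → Bool
  head (x ∷ _) = x
  tail : Subset (suc n) → Subset n
  tail (_ ∷ p) = p
  head∷tail : ∀ p → head p ∷ tail p ≡ p
  head∷tail (_ ∷ _) = refl
  heads : ∀ i j → i ≢ j → head (S i) ∨ head (S j) ≡ u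
  heads i j i≢j with S i | S j | h i j i≢j
  ... | _ ∷ _ | _ ∷ _ | refl = refl
  tails : ∀ i j → i ≢ j → tail (S i) ∪ tail (S j) ≡ U
  tails i j i≢j with S i | S j | h i j i≢j
  ... | _ ∷ _ | _ ∷ _ | refl = refl

ordered-pairs⇒distinct-pairs : (S : Fin k → Subset n) →
  (∀ i j i′ j′ → i < j → i′ < j′ → S i ∪ S j ≡ S i′ ∪ S j′) →
  ∀ {i₀ j₀} → i₀ < j₀ → ∀ i j → i ≢ j → S i ∪ S j ≡ S i₀ ∪ S j₀
ordered-pairs⇒distinct-pairs S same i₀<j₀ i j i≢j with <-cmp i j
... | tri< i<j _ _   = same i j _ _ i<j i₀<j₀
... | tri≈ _ i≡j _   = contradiction i≡j i≢j
... | tri> _ _ j<i   = trans (∪-comm (S i) (S j)) (same j i _ _ j<i i₀<j₀)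

[2+m]*u≤[3+m]*[1+m]⇒u≤1+m : ∀ m u → (2 + m) * u ≤ (3 + m) * (1 + m) → u ≤ 1 + m
[2+m]*u≤[3+m]*[1+m]⇒u≤1+m m u h =
  <⇒≤pred (*-cancelˡ-< (2 + m) u (2 + m) (≤-trans (s≤s h) (≤-reflexive (1+[3+m]*[1+m]≡[2+m]² m))))
  where
  open +-*-Solver
  1+[3+m]*[1+m]≡[2+m]² : ∀ m → 1 + (3 + m) * (1 + m) ≡ (2 + m) * (2 + m)
  1+[3+m]*[1+m]≡[2+m]² = solve 1
    (λ m → con 1 :+ (con 3 :+ m) :* (con 1 :+ m) := (con 2 :+ m) :* (con 2 :+ m)) refl

lemma3p1 : (n k : ℕ) → 3 ≤ k → (S : Fin k → Subset n) →
    (∀ i → ∣ S i ∣ ≡ k ∸ 2) →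
    (∀ i j i′ j′ → i < j → i′ < j′ → S i ∪ S j ≡ S i′ ∪ S j′) →
    ∀ i j → S i ≡ S j
lemma3p1 n .(3 + m) (s≤s (s≤s (s≤s {n = m} z≤n))) S ∣Sᵢ∣≡k∸2 same i j = trans (Sᵢ≡U i) (sym (Sᵢ≡U j))
  where
  U : Subset n
  U = S zero ∪ S (suc zero)
  distinct-pairs : ∀ i j → i ≢ j → S i ∪ S j ≡ U
  distinct-pairs = ordered-pairs⇒distinct-pairs S same (s≤s z≤n)
  ∣U∣≤1+m : ∣ U ∣ ≤ 1 + m
  ∣U∣≤1+m = [2+m]*u≤[3+m]*[1+m]⇒u≤1+m m ∣ U ∣ (begin
    (2 + m) * ∣ U ∣        ≤⟨ pairwise-∪⇒∑≥ S U distinct-pairs ⟩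
    ∑[ i < 3 + m ] ∣ S i ∣ ≡⟨ sum-cong-≗ ∣Sᵢ∣≡k∸2 ⟩
    ∑[ i < 3 + m ] (1 + m) ≡⟨ ∑-const (3 + m) (1 + m) ⟩
    (3 + m) * (1 + m)      ∎)
    where open ≤-Reasoning
  Sᵢ≡U : ∀ i → S i ≡ U
  Sᵢ≡U i = trans (sym (∣p∪q∣≤∣p∣⇒p∪q≡p (S i) (S i′) ∣Sᵢ∪Sᵢ′∣≤∣Sᵢ∣)) (distinct-pairs i i′ i≢i′)
    where
    i′ : Fin (3 + m)
    i′ = punchIn i zero
    i≢i′ : i ≢ i′
    i≢i′ = punchInᵢ≢i i zero ∘ sym
    ∣Sᵢ∪Sᵢ′∣≤∣Sᵢ∣ : ∣ S i ∪ S i′ ∣ ≤ ∣ S i ∣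
    ∣Sᵢ∪Sᵢ′∣≤∣Sᵢ∣ = subst₂ _≤_ (cong ∣_∣ (sym (distinct-pairs i i′ i≢i′))) (sym (∣Sᵢ∣≡k∸2 i)) ∣U∣≤1+m
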